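{- Let $H$ be a homogeneous relation on a finite set $X$. If $H$ is weakly graphic, then its family of homogeneous modules is partitive; if $H$ is weakly digraphic, then its family of homogeneous modules is weakly partitive.
   Context: A diverse triple of $X$ is $(x,y,z)\in X^3$ with $x\neq y$, $x\neq z$, written $(x|yz)$. A homogeneous relation $H$ on $X$ is a relation on diverse triples such that for every $x\in X$ the relation $H_x(y,z)\Leftrightarrow H(x|yz)$ is an equivalence relation on $X\setminus\{x\}$. $M\subseteq X$ is a homogeneous module if $H(x|mm')$ for all $m,m'\in M$, $x\in X\setminus M$. $H$ is weakly graphic if $H(y|xz)\wedge H(z|xy)\Rightarrow H(x|yz)$ for all pairwise distinct $x,y,z\in X$; $H$ is weakly digraphic if $H(s|xy)\wedge H(t|xy)\wedge H(y|sx)\wedge H(y|tx)\Rightarrow H(x|st)$ for all $x,y,s,t\in X$ (whenever the triples are diverse). Sets $A,B$ overlap if $A\cap B$, $A\setminus B$, $B\setminus A$ are all non-empty. A family $\mathcal F$ of subsets of $X$ is weakly partitive if it contains $X$ and all singletons and, for all overlapping $A,B\in\mathcal F$, contains $A\cap B$, $A\cup B$, $A\setminus B$; it is partitive if moreover it contains the symmetric difference $(A\setminus B)\cup(B\setminus A)$ for all overlapping $A,B\in\mathcal F$. -}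

module Defs where

open import Data.Nat using (ℕ)
open import Data.Fin using (Fin)
open import Data.Fin.Subset using (Subset; _∈_; _∉_; _∩_; _∪_; _─_; ⊤; ⁅_⁆; Nonempty)
open import Data.Product using (_×_)
open import Relation.Binary.PropositionalEquality using (_≢_)

-- The finite set X is modelled as Fin n.  A ternary relation
-- H x y z  stands for  H(x|yz).  Only its values on diverse triples
-- (x ≢ y, x ≢ z) are ever used.
TernRel : ℕ → Set₁
TernRel n = Fin n → Fin n → Fin n → Set

record IsHomogeneous {n : ℕ} (H : TernRel n) : Set where
  field
    hrefl  : ∀ x y → x ≢ y → H x y y
    hsym   : ∀ x y z → x ≢ y → x ≢ z → H x y z → H x z y
    htrans : ∀ x y z w → x ≢ y → x ≢ z → x ≢ w → H x y z → H x z w → H x y w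

IsModule : {n : ℕ} → TernRel n → Subset n → Set
IsModule H M = ∀ m m' x → m ∈ M → m' ∈ M → x ∉ M → H x m m'

WeaklyGraphic : {n : ℕ} → TernRel n → Set
WeaklyGraphic H = ∀ x y z → x ≢ y → x ≢ z → y ≢ z → H y x z → H z x y → H x y z

WeaklyDigraphic : {n : ℕ} → TernRel n → Set
WeaklyDigraphic H = ∀ x y s t → x ≢ y → s ≢ x → s ≢ y → t ≢ x → t ≢ y →
  H s x y → H t x y → H y s x → H y t x → H x s t

Family : ℕ → Set₁
Family n = Subset n → Set

Overlap : {n : ℕ} → Subset n → Subset n → Set
Overlap A B = Nonempty (A ∩ B) × Nonempty (A ─ B) × Nonempty (B ─ A)

WeaklyPartitive : {n : ℕ} → Family n → Set
WeaklyPartitive {n} F =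
  F ⊤ × (∀ (i : Fin n) → F ⁅ i ⁆) ×
  (∀ A B → F A → F B → Overlap A B → F (A ∩ B) × F (A ∪ B) × F (A ─ B))

Partitive : {n : ℕ} → Family n → Set
Partitive F = WeaklyPartitive F ×
  (∀ A B → F A → F B → Overlap A B → F ((A ─ B) ∪ (B ─ A)))

-- Intersections and unions of overlapping modules are modules because H_x is an
-- equivalence relation: any two points of A ∪ B are H_x-related to a common point
-- of A ∩ B.  The difference A ─ B is the only place where the axioms enter.  For
-- x ∈ A ∩ B, m ∈ A ─ B and b ∈ B ─ A, the module property of A gives H(m|xb) and
-- that of B gives H(b|xm); weak graphicity turns these into H(x|mb), so b is a
-- common H_x-representative of A ─ B.  Weak digraphicity gives H(x|mm') for
-- m, m' ∈ A ─ B directly.  The symmetric difference then follows by the same hub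
-- argument, using that B ─ A is a module too.
module Submission where

open import Defs
open import Data.Nat using (ℕ)
open import Data.Product using (_×_; _,_; proj₁; proj₂)
open import Data.Sum using (inj₁; inj₂; [_,_]′)
open import Data.Fin using (zero)
open import Data.Vec using (_∷_; here; there)
open import Data.Fin.Subset using (Subset; _∈_; _∉_; _⊆_; _∩_; _∪_; _─_; ⊤; ⁅_⁆; Nonempty; inside; outside)
open import Data.Fin.Subset.Properties using (_∈?_; x∈p∩q⁺; x∈p∩q⁻; x∈p∪q⁺; x∈p∪q⁻; ∈⊤; x∈⁅y⁆⇒x≡y)
open import Relation.Binary.PropositionalEquality using (refl; _≢_; ≢-sym)
open import Relation.Nullary using (yes; no)
open import Data.Empty using (⊥-elim)

private variable
  n : ℕ

x∈p─q⁻ : ∀ (p q : Subset n) {x} → x ∈ p ─ q → x ∈ p × x ∉ q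
x∈p─q⁻ (inside  ∷ p) (outside ∷ q) here      = here , λ ()
x∈p─q⁻ (outside ∷ p) (outside ∷ q) {zero} ()
x∈p─q⁻ (outside ∷ p) (inside  ∷ q) {zero} ()
x∈p─q⁻ (_       ∷ p) (_       ∷ q) (there h) with x∈p─q⁻ p q h
... | x∈p , x∉q = there x∈p , λ { (there x∈q) → x∉q x∈q }

x∈p─q⁺ : ∀ {p q : Subset n} {x} → x ∈ p → x ∉ q → x ∈ p ─ q
x∈p─q⁺ {p = inside ∷ p} {outside ∷ q} here      x∉q = here
x∈p─q⁺ {p = inside ∷ p} {inside  ∷ q} here      x∉q = ⊥-elim (x∉q here)
x∈p─q⁺ {p = _      ∷ p} {_       ∷ q} (there h) x∉q = there (x∈p─q⁺ h (λ x∈q → x∉q (there x∈q)))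

p─q⊆p : ∀ (p q : Subset n) → p ─ q ⊆ p
p─q⊆p p q x∈ = proj₁ (x∈p─q⁻ p q x∈)

p△q⊆p∪q : ∀ (p q : Subset n) → (p ─ q) ∪ (q ─ p) ⊆ p ∪ q
p△q⊆p∪q p q x∈ with x∈p∪q⁻ (p ─ q) (q ─ p) x∈
... | inj₁ x∈p─q = x∈p∪q⁺ (inj₁ (p─q⊆p p q x∈p─q))
... | inj₂ x∈q─p = x∈p∪q⁺ (inj₂ (p─q⊆p q p x∈q─p))

∈∉⇒≢ : ∀ {S : Subset n} {x y} → x ∈ S → y ∉ S → x ≢ y
∈∉⇒≢ x∈ y∉ refl = y∉ x∈

∉∈⇒≢ : ∀ {S : Subset n} {x y} → x ∉ S → y ∈ S → x ≢ y
∉∈⇒≢ x∉ y∈ = ≢-sym (∈∉⇒≢ y∈ x∉)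

module Modules {n : ℕ} (H : TernRel n) (hom : IsHomogeneous H) where
  open IsHomogeneous hom

  H-via : ∀ {x m m' c} → x ≢ m → x ≢ m' → x ≢ c → H x m c → H x m' c → H x m m'
  H-via {x} {m} {m'} {c} x≢m x≢m' x≢c Hxmc Hxm'c =
    htrans x m c m' x≢m x≢c x≢m' Hxmc (hsym x m' c x≢m' x≢c Hxm'c)

  ⊤-isModule : IsModule H ⊤
  ⊤-isModule _ _ _ _ _ x∉⊤ = ⊥-elim (x∉⊤ ∈⊤)

  ⁅⁆-isModule : ∀ i → IsModule H ⁅ i ⁆
  ⁅⁆-isModule i m m' x m∈ m'∈ x∉ with x∈⁅y⁆⇒x≡y i m∈ | x∈⁅y⁆⇒x≡y i m'∈
  ... | refl | refl = hrefl x m (∉∈⇒≢ x∉ m∈)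

  ∩-isModule : ∀ A B → IsModule H A → IsModule H B → IsModule H (A ∩ B)
  ∩-isModule A B MA MB m m' x m∈ m'∈ x∉ with x∈p∩q⁻ A B m∈ | x∈p∩q⁻ A B m'∈ | x ∈? A
  ... | mA , _  | m'A , _   | no x∉A  = MA m m' x mA m'A x∉A
  ... | _  , mB | _   , m'B | yes x∈A = MB m m' x mB m'B (λ x∈B → x∉ (x∈p∩q⁺ (x∈A , x∈B)))

  ∪-isModule : ∀ A B → IsModule H A → IsModule H B → Nonempty (A ∩ B) → IsModule H (A ∪ B)
  ∪-isModule A B MA MB (c , c∈A∩B) m m' x m∈ m'∈ x∉ =
    H-via (∉∈⇒≢ x∉ m∈) (∉∈⇒≢ x∉ m'∈) (∉∈⇒≢ x∉ c∈A∪B) (toC m∈) (toC m'∈)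
    where
    c∈A = proj₁ (x∈p∩q⁻ A B c∈A∩B)
    c∈B = proj₂ (x∈p∩q⁻ A B c∈A∩B)
    c∈A∪B = x∈p∪q⁺ (inj₁ c∈A)
    toC : ∀ {y} → y ∈ A ∪ B → H x y c
    toC {y} y∈ with x∈p∪q⁻ A B y∈
    ... | inj₁ y∈A = MA y c x y∈A c∈A (λ x∈A → x∉ (x∈p∪q⁺ (inj₁ x∈A)))
    ... | inj₂ y∈B = MB y c x y∈B c∈B (λ x∈B → x∉ (x∈p∪q⁺ (inj₂ x∈B)))

  ─-isModule : ∀ A B → IsModule H A →
    (∀ x m m' → x ∈ A → x ∈ B → m ∈ A ─ B → m' ∈ A ─ B → H x m m') →
    IsModule H (A ─ B)
  ─-isModule A B MA inside-A∩B m m' x m∈ m'∈ x∉ with x ∈? A | x ∈? B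
  ... | no x∉A  | _       = MA m m' x (p─q⊆p A B m∈) (p─q⊆p A B m'∈) x∉A
  ... | yes x∈A | no x∉B  = ⊥-elim (x∉ (x∈p─q⁺ x∈A x∉B))
  ... | yes x∈A | yes x∈B = inside-A∩B x m m' x∈A x∈B m∈ m'∈

  module Graphic (WG : WeaklyGraphic H) where

    crossing : ∀ A B → IsModule H A → IsModule H B →
      ∀ {x m b} → x ∈ A → x ∈ B → m ∈ A ─ B → b ∈ B ─ A → H x m b
    crossing A B MA MB {x} {m} {b} x∈A x∈B m∈ b∈ =
      WG x m b (∈∉⇒≢ x∈B m∉B) (∈∉⇒≢ x∈A b∉A) (∈∉⇒≢ m∈A b∉A)
        (MB x b m x∈B b∈B m∉B) (MA x m b x∈A m∈A b∉A)
      where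
      m∈A = proj₁ (x∈p─q⁻ A B m∈)
      m∉B = proj₂ (x∈p─q⁻ A B m∈)
      b∈B = proj₁ (x∈p─q⁻ B A b∈)
      b∉A = proj₂ (x∈p─q⁻ B A b∈)

    ─-isModule-graphic : ∀ A B → IsModule H A → IsModule H B → Nonempty (B ─ A) → IsModule H (A ─ B)
    ─-isModule-graphic A B MA MB (b , b∈) = ─-isModule A B MA λ x m m' x∈A x∈B m∈ m'∈ →
      H-via (∈∉⇒≢ x∈B (proj₂ (x∈p─q⁻ A B m∈))) (∈∉⇒≢ x∈B (proj₂ (x∈p─q⁻ A B m'∈)))
        (∈∉⇒≢ x∈A (proj₂ (x∈p─q⁻ B A b∈)))
        (crossing A B MA MB x∈A x∈B m∈ b∈) (crossing A B MA MB x∈A x∈B m'∈ b∈)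

    △-isModule : ∀ A B → IsModule H A → IsModule H B → Overlap A B → IsModule H ((A ─ B) ∪ (B ─ A))
    △-isModule A B MA MB (A∩B≠∅ , A─B≠∅ , b , b∈) m m' x m∈ m'∈ x∉ with x ∈? A | x ∈? B
    ... | yes x∈A | no x∉B  = ⊥-elim (x∉ (x∈p∪q⁺ (inj₁ (x∈p─q⁺ x∈A x∉B))))
    ... | no x∉A  | yes x∈B = ⊥-elim (x∉ (x∈p∪q⁺ (inj₂ (x∈p─q⁺ x∈B x∉A))))
    ... | no x∉A  | no x∉B  =
      ∪-isModule A B MA MB A∩B≠∅ m m' x (p△q⊆p∪q A B m∈) (p△q⊆p∪q A B m'∈)
        (λ x∈A∪B → [ x∉A , x∉B ]′ (x∈p∪q⁻ A B x∈A∪B))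
    ... | yes x∈A | yes x∈B = H-via (∉∈⇒≢ x∉ m∈) (∉∈⇒≢ x∉ m'∈) (∈∉⇒≢ x∈A (proj₂ (x∈p─q⁻ B A b∈)))
      (toB m∈) (toB m'∈)
      where
      B─A-isModule = ─-isModule-graphic B A MB MA A─B≠∅
      toB : ∀ {y} → y ∈ (A ─ B) ∪ (B ─ A) → H x y b
      toB {y} y∈ with x∈p∪q⁻ (A ─ B) (B ─ A) y∈
      ... | inj₁ y∈A─B = crossing A B MA MB x∈A x∈B y∈A─B b∈
      ... | inj₂ y∈B─A = B─A-isModule y b x y∈B─A b∈ (λ x∈B─A → proj₂ (x∈p─q⁻ B A x∈B─A) x∈A)

  ─-isModule-digraphic : WeaklyDigraphic H →
    ∀ A B → IsModule H A → IsModule H B → Nonempty (B ─ A) → IsModule H (A ─ B)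
  ─-isModule-digraphic WD A B MA MB (b , b∈) = ─-isModule A B MA λ x m m' x∈A x∈B m∈ m'∈ →
    let m∈A = proj₁ (x∈p─q⁻ A B m∈);  m∉B = proj₂ (x∈p─q⁻ A B m∈)
        m'∈A = proj₁ (x∈p─q⁻ A B m'∈); m'∉B = proj₂ (x∈p─q⁻ A B m'∈)
        b∈B = proj₁ (x∈p─q⁻ B A b∈);   b∉A = proj₂ (x∈p─q⁻ B A b∈)
    in WD x b m m' (∈∉⇒≢ x∈A b∉A) (∉∈⇒≢ m∉B x∈B) (∈∉⇒≢ m∈A b∉A) (∉∈⇒≢ m'∉B x∈B) (∈∉⇒≢ m'∈A b∉A)
         (MB x b m x∈B b∈B m∉B) (MB x b m' x∈B b∈B m'∉B) (MA m x b m∈A x∈A b∉A) (MA m' x b m'∈A x∈A b∉A)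

  weaklyPartitive : (∀ A B → IsModule H A → IsModule H B → Nonempty (B ─ A) → IsModule H (A ─ B)) →
    WeaklyPartitive (IsModule H)
  weaklyPartitive ─-closed = ⊤-isModule , ⁅⁆-isModule , λ A B MA MB (A∩B≠∅ , _ , B─A≠∅) →
    ∩-isModule A B MA MB , ∪-isModule A B MA MB A∩B≠∅ , ─-closed A B MA MB B─A≠∅

proposition10 : (n : ℕ) (H : TernRel n) → IsHomogeneous H →
    (WeaklyGraphic H → Partitive (IsModule H)) ×
    (WeaklyDigraphic H → WeaklyPartitive (IsModule H))
proposition10 n H hom =
  (λ WG → let open Graphic WG in weaklyPartitive ─-isModule-graphic , △-isModule) ,
  (λ WD → weaklyPartitive (─-isModule-digraphic WD))
  where open Modules H hom
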